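{- There exist two polychromatic models $\mathcal{C}$ and $\mathcal{C}'$, a morphism $f$ from $\mathcal{C}$ to $\mathcal{C}'$, a world $X$ of $\mathcal{C}$, an agent $a$ and an atomic proposition $p\in\mathsf{Prop}$ such that \[ \mathcal{C}',f(X)\Vdash[\unrhd]_a p\quad\text{but}\quad\mathcal{C},X\not\Vdash[\unrhd]_a p . \]
   Context: A simplicial complex is a pair $C=(S,\mathcal{V})$ with $S\subseteq\mathcal{P}(\mathcal{V})\setminus\{\emptyset\}$ closed under nonempty subsets; $\mathcal{F}(C)$ is its set of inclusion-maximal elements. Fix a finite set of agents $\mathsf{Ag}$ and a set $\mathsf{Prop}$ of atomic propositions. A polychromatic model is $\mathcal{C}=(C,\chi,W,\ell)$ with $C=(S,\mathcal{V})$ a simplicial complex, $\chi:\mathcal{V}\to\mathsf{Ag}$ an arbitrary coloring, $\mathcal{F}(C)\subseteq W\subseteq S$, $\ell:W\to\mathcal{P}(\mathsf{Prop})$, satisfying: for all $X,Y,Z\in W$ and $G\subseteq\mathsf{Ag}$, $G\subseteq\chi(X\cap Y)$ and $G\subseteq\chi(Y\cap Z)$ imply $G\subseteq\chi(X\cap Z)$, where $\chi(U)=\{\chi(u)\mid u\in U\}$. Write $X\sim_a Y$ iff $a\in\chi(X\cap Y)$, $m_a(X)=|\{v\in X\mid\chi(v)=a\}|$, and $X\unrhd_a Y$ iff $X\sim_a Y$ and $m_a(X)\ge m_a(Y)$. Truth: $\mathcal{C},X\Vdash p$ iff $p\in\ell(X)$; $\mathcal{C},X\Vdash[\unrhd]_a\phi$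 iff $\mathcal{C},Y\Vdash\phi$ for all $Y\in W$ with $X\unrhd_a Y$. A simplicial map from $C=(S,\mathcal{V})$ to $C'=(S',\mathcal{V}')$ is $f:\mathcal{V}\to\mathcal{V}'$ with $f(X)=\{f(x)\mid x\in X\}\in S'$ for all $X\in S$. A morphism from $\mathcal{C}=(C,\chi,W,\ell)$ to $\mathcal{C}'=(C',\chi',W',\ell')$ is a simplicial map $f$ from $C$ to $C'$ with $\chi'(f(v))=\chi(v)$ for all $v\in\mathcal{V}$, $f(X)\in W'$ and $\ell'(f(X))=\ell(X)$ for all $X\in W$. -}

module Defs where

open import Data.Nat using (ℕ; suc; _≥_)
open import Data.Fin using (Fin; _≟_)
open import Data.Fin.Properties using (any?)
open import Data.Fin.Subset using (Subset; _∈_; _⊆_; _∩_; ∣_∣; Nonempty)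
open import Data.Fin.Subset.Properties using (_∈?_)
open import Data.Vec using (tabulate)
open import Data.Product using (Σ; ∃; _×_; _,_)
open import Relation.Binary.PropositionalEquality using (_≡_)
open import Relation.Nullary using (¬_; does)
open import Relation.Nullary.Decidable using (_×-dec_)
open import Function.Bundles using (_⇔_)

Ag : ℕ → Set
Ag n = Fin (suc n)

record SimplicialComplex (k : ℕ) : Set₁ where
  field
    S        : Subset k → Set
    nonempty : ∀ X → S X → Nonempty X
    closed   : ∀ X Y → S X → Nonempty Y → Y ⊆ X → S Y
open SimplicialComplex public

IsFacet : ∀ {k} → SimplicialComplex k → Subset k → Set
IsFacet C X = S C X × (∀ Y → S C Y → X ⊆ Y → Y ≡ X)

_∈χ[_]_ : ∀ {k n} → Ag n → (Fin k → Ag n) → Subset k → Set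
a ∈χ[ χ ] U = ∃ λ v → v ∈ U × χ v ≡ a

_⊆χ[_]_ : ∀ {k n} → Subset (suc n) → (Fin k → Ag n) → Subset k → Set
G ⊆χ[ χ ] U = ∀ a → a ∈ G → a ∈χ[ χ ] U

-- Polychromatic model with propositions in the type Prop.
-- ℓ is given as a total function on subsets; only its values on W matter.
record PolyModel (n : ℕ) (Prop : Set) : Set₁ where
  field
    k     : ℕ
    cx    : SimplicialComplex k
    χ     : Fin k → Ag n
    W     : Subset k → Set
    F⊆W   : ∀ X → IsFacet cx X → W X
    W⊆S   : ∀ X → W X → S cx X
    ℓ     : Subset k → Prop → Set
    trans : ∀ X Y Z → W X → W Y → W Z → (G : Subset (suc n)) →
            G ⊆χ[ χ ] (X ∩ Y) → G ⊆χ[ χ ] (Y ∩ Z) → G ⊆χ[ χ ] (X ∩ Z)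
open PolyModel public

module _ {n : ℕ} {Prop : Set} (M : PolyModel n Prop) where
  Indist : Ag n → Subset (k M) → Subset (k M) → Set
  Indist a X Y = a ∈χ[ χ M ] (X ∩ Y)

  colourClass : Ag n → Subset (k M)
  colourClass a = tabulate (λ v → does (χ M v ≟ a))

  mult : Ag n → Subset (k M) → ℕ
  mult a X = ∣ X ∩ colourClass a ∣

  Geq : Ag n → Subset (k M) → Subset (k M) → Set
  Geq a X Y = Indist a X Y × mult a X ≥ mult a Y

  BoxAtom : Ag n → Prop → Subset (k M) → Set
  BoxAtom a p X = ∀ Y → W M Y → Geq a X Y → ℓ M Y p

image : ∀ {k k'} → (Fin k → Fin k') → Subset k → Subset k'
image f X = tabulate (λ y → does (any? (λ x → (x ∈? X) ×-dec (f x ≟ y))))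

record Morphism {n : ℕ} {Prop : Set} (M M' : PolyModel n Prop) : Set where
  field
    fun     : Fin (k M) → Fin (k M')
    simpl   : ∀ X → S (cx M) X → S (cx M') (image fun X)
    colour  : ∀ v → χ M' (fun v) ≡ χ M v
    worlds  : ∀ X → W M X → W M' (image fun X)
    labels  : ∀ X → W M X → ∀ p → ℓ M' (image fun X) p ⇔ ℓ M X p
open Morphism public

{-# OPTIONS --safe #-}
module Submission where

-- A morphism may identify vertices of equal colour, so it can lower the multiplicity m_a of a
-- world without lowering that of another.  In C all vertices have colour a and the worlds are
-- A = {0,1} and B = {0,2}, which share vertex 0; hence A ⊵_a B, and p holds at A but not at B.
-- Collapsing 0 and 1 sends A to {0} and B to {0,1} in C', where m_a drops to 1 at f(A) but
-- stays 2 at f(B); so f(A) ⊵_a f(B) fails and the only world f(A) sees is f(A) itself.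

open import Defs
open import Data.Nat using (ℕ; suc; s≤s)
open import Data.Nat.Properties using (≤-refl)
open import Data.Fin using (Fin; zero; suc; _≟_)
open import Data.Fin.Properties using (any?)
open import Data.Fin.Subset using (Subset; _∈_; _⊆_; _∩_; Nonempty; inside; outside; ⊤)
open import Data.Fin.Subset.Properties using (_∈?_; x∈p∩q⁺; ⊆-refl; ⊆-trans)
open import Data.Vec using ([]; _∷_; here)
open import Data.Vec.Properties using (lookup∘tabulate; []=⇒lookup; lookup⇒[]=)
open import Data.Product using (Σ; ∃; _×_; _,_)
open import Data.Sum using (_⊎_; inj₁; inj₂)
open import Relation.Nullary using (¬_)
open import Relation.Nullary.Decidable using (yes; no; dec-true; _×-dec_)
open import Relation.Binary.PropositionalEquality using (_≡_; refl; sym) renaming (trans to ≡-trans)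
open import Function.Bundles using (mk⇔)

module _ {k k′ : ℕ} (f : Fin k → Fin k′) where

  ∈-image : ∀ {X x} → x ∈ X → f x ∈ image f X
  ∈-image {X} {x} x∈X = lookup⇒[]= (f x) (image f X)
    (≡-trans (lookup∘tabulate _ (f x))
           (dec-true (any? (λ y → (y ∈? X) ×-dec (f y ≟ f x))) (x , x∈X , refl)))

  ∈-image⁻ : ∀ {X y} → y ∈ image f X → ∃ λ x → x ∈ X × f x ≡ y
  ∈-image⁻ {X} {y} y∈fX
    with any? (λ x → (x ∈? X) ×-dec (f x ≟ y))
       | ≡-trans (sym (lookup∘tabulate _ y)) ([]=⇒lookup y∈fX)
  ... | yes witness | _  = witness
  ... | no _        | ()

  image-mono : ∀ {X Y} → X ⊆ Y → image f X ⊆ image f Y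
  image-mono X⊆Y y∈fX with ∈-image⁻ y∈fX
  ... | x , x∈X , refl = ∈-image (X⊆Y x∈X)

generatedComplex : ∀ {k} → (Subset k → Set) → SimplicialComplex k
generatedComplex G = record
  { S        = λ X → Nonempty X × ∃ λ F → G F × X ⊆ F
  ; nonempty = λ { X (ne , _) → ne }
  ; closed   = λ { X Y (_ , F , gF , X⊆F) ne Y⊆X → ne , F , gF , ⊆-trans Y⊆X X⊆F }
  }

generatedComplex-facet⇒generator : ∀ {k} {G : Subset k → Set} {X} →
  IsFacet (generatedComplex G) X → G X
generatedComplex-facet⇒generator (((x , x∈X) , F , gF , X⊆F) , maximal)
  with maximal F ((x , X⊆F x∈X) , F , gF , ⊆-refl) X⊆F
... | refl = gF

generatedComplex-image : ∀ {k k′} {G : Subset k → Set} {G′ : Subset k′ → Set}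
  (f : Fin k → Fin k′) → (∀ F → G F → G′ (image f F)) →
  ∀ X → S (generatedComplex G) X → S (generatedComplex G′) (image f X)
generatedComplex-image f image-gen X ((x , x∈X) , F , gF , X⊆F) =
  (f x , ∈-image f x∈X) , image f F , image-gen F gF , image-mono f X⊆F

module _ {n : ℕ} {Prop : Set} where

  -- With a single colour c every nonempty G ⊆ χ(·) is {c}, and a vertex shared by all worlds
  -- puts c in every χ(X ∩ Z).
  monochromatic-transitive : ∀ {k} (c : Ag n) (W : Subset k → Set) (v : Fin k) →
    (∀ X → W X → v ∈ X) →
    ∀ X Y Z → W X → W Y → W Z → (G : Subset (suc n)) →
    G ⊆χ[ (λ _ → c) ] (X ∩ Y) → G ⊆χ[ (λ _ → c) ] (Y ∩ Z) → G ⊆χ[ (λ _ → c) ] (X ∩ Z)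
  monochromatic-transitive c W v v∈W X _ Z wX _ wZ G G⊆XY _ a a∈G
    with G⊆XY a a∈G
  ... | _ , _ , refl = v , x∈p∩q⁺ (v∈W X wX , v∈W Z wZ) , refl

  monochromaticModel : ∀ {k} (c : Ag n) (W : Subset k → Set) (v : Fin k) →
    (∀ X → W X → v ∈ X) → (Subset k → Prop → Set) → PolyModel n Prop
  monochromaticModel {k} c W v v∈W ℓ = record
    { k     = k
    ; cx    = generatedComplex W
    ; χ     = λ _ → c
    ; W     = W
    ; F⊆W   = λ X → generatedComplex-facet⇒generator
    ; W⊆S   = λ X wX → (v , v∈W X wX) , X , wX , ⊆-refl
    ; ℓ     = ℓ
    ; trans = monochromatic-transitive c W v v∈W
    }

module Counterexample (n : ℕ) (Prop : Set) where

  A B : Subset 3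
  A = inside ∷ inside ∷ outside ∷ []
  B = inside ∷ outside ∷ inside ∷ []

  isWorld : Subset 3 → Set
  isWorld X = X ≡ A ⊎ X ≡ B

  0∈isWorld : ∀ X → isWorld X → zero ∈ X
  0∈isWorld X (inj₁ refl) = here
  0∈isWorld X (inj₂ refl) = here

  C : PolyModel n Prop
  C = monochromaticModel zero isWorld zero 0∈isWorld (λ X _ → X ≡ A)

  A′ : Subset 2
  A′ = inside ∷ outside ∷ []

  isWorld′ : Subset 2 → Set
  isWorld′ X = X ≡ A′ ⊎ X ≡ ⊤

  0∈isWorld′ : ∀ X → isWorld′ X → zero ∈ X
  0∈isWorld′ X (inj₁ refl) = here
  0∈isWorld′ X (inj₂ refl) = here

  C′ : PolyModel n Prop
  C′ = monochromaticModel zero isWorld′ zero 0∈isWorld′ (λ X _ → X ≡ A′)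

  collapse : Fin 3 → Fin 2
  collapse zero          = zero
  collapse (suc zero)    = zero
  collapse (suc (suc _)) = suc zero

  collapse-preserves-worlds : ∀ X → isWorld X → isWorld′ (image collapse X)
  collapse-preserves-worlds X (inj₁ refl) = inj₁ refl
  collapse-preserves-worlds X (inj₂ refl) = inj₂ refl

  f : Morphism C C′
  f = record
    { fun    = collapse
    ; simpl  = generatedComplex-image collapse collapse-preserves-worlds
    ; colour = λ _ → refl
    ; worlds = collapse-preserves-worlds
    ; labels = λ { X (inj₁ refl) _ → mk⇔ (λ _ → refl) (λ _ → refl)
                 ; X (inj₂ refl) _ → mk⇔ (λ ()) (λ ()) }
    }

  boxAtom-image : ∀ p → BoxAtom C′ zero p (image collapse A)
  boxAtom-image p Y (inj₁ refl) _            = refl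
  boxAtom-image p Y (inj₂ refl) (_ , s≤s ())

  ¬boxAtom-A : ∀ p → ¬ BoxAtom C zero p A
  ¬boxAtom-A p box with box B (inj₂ refl) ((zero , here , refl) , ≤-refl)
  ... | ()

mainTheorem8 : (n : ℕ) (Prop : Set) → Prop →
    Σ (PolyModel n Prop) λ C → Σ (PolyModel n Prop) λ C' →
    Σ (Morphism C C') λ f → Σ (Subset (k C)) λ X → W C X ×
    Σ (Ag n) λ a → Σ Prop λ p →
      BoxAtom C' a p (image (fun f) X) × ¬ BoxAtom C a p X
mainTheorem8 n Prop p =
  C , C′ , f , A , inj₁ refl , zero , p , boxAtom-image p , ¬boxAtom-A p
  where open Counterexample n Prop
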